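{- Let $\mathbf g=\{L_1,\dots,L_n\}$ be a generalised arrangement of $n$ pseudolines. Suppose there exist $i,j\in[n]$ such that the pseudolines $L_i$ and $L_j$ intersect (at least) twice, at two vertices lying at different levels. Then the domain $\mathcal D(\mathbf g)$ is not a Condorcet domain.
   Context: Let $L$ and $R$ be two vertical lines in $\mathbb R^2$, $L$ to the left of $R$, and let $E$ be the closed strip between them. A pseudoline is the graph of a continuous function, lying in $E$, connecting a point of $L$ to a point of $R$. A generalised arrangement of $n$ pseudolines is a family $\mathbf g=\{L_1,\dots,L_n\}$ of pseudolines, labelled so that they meet $L$ in increasing order of label from top to bottom, such that any two of them meet in finitely many points, each of which is a crossing, and no point lies on three of them; unlike a classical arrangement of pseudolines, two pseudolines may cross any number of times (including zero). The intersection points of pseudolines are called vertices. A vertex has level $\ell$ if, on the vertical line through it, exactly $\ell-1$ pseudolines pass above it (so it is the crossing of the pseudolines in positions $\ell$ and $\ell+1$ counted from the top). The chambers are the connected components of $E\setminus\bigcup_i L_i$; the chamber set of a chamber $C$ is the set of $i\in[n]$ such that $L_i$ passes above $C$ (so the top chamber has chamber set $\emptyset$ and the bottom chamber has chamber set $[n]$). A linear order $a_1a_2\dots a_n$ of $[n]$ (listed from best to worst) belongs to $\mathcal D(\mathbf g)$ iff every set $\{a_1,\dots,a_k\}$, $0\le k\le n$, is a chamber set of $\mathbf g$. A Condorcet domain is a set of linear orders on a finite set of alternatives such that, for every profile (multiset) of orders from it, the pairwise majority relation is acyclic (equivalently, the restriction of the domain to any triple of alternatives contains no Condorcet cycle $abc,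 bca, cab$ configuration). -}

module Defs where

open import Data.Nat using (ℕ; zero; suc; _<_; _≤_)
open import Data.Nat.Properties using (<⇒≤)
open import Data.Fin using (Fin; toℕ; fromℕ<)
import Data.Fin as F
open import Data.Fin.Permutation using (Permutation′; _⟨$⟩ʳ_)
open import Data.Fin.Permutation.Components using (transpose)
open import Data.List using (List; length; take; foldl; lookup; filter)
open import Data.List.Relation.Unary.All using (All)
open import Data.Product using (Σ; ∃; ∃-syntax; _×_; _,_; proj₁)
open import Data.Sum using (_⊎_)
open import Data.Empty using (⊥)
open import Function using (_∘_; id)
open import Function.Bundles using (_⇔_)
open import Relation.Nullary using (¬_)
open import Relation.Binary.PropositionalEquality using (_≡_; _≢_)
open import Relation.Binary.Construct.Closure.Transitive using (TransClosure)

-- Combinatorial model of a generalised arrangement of n pseudolines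
-- (wiring diagram).  Pseudolines are labelled by Fin n (label a = L_{a+1}),
-- positions on a vertical line are Fin n counted from the top (0 = top).
-- Sweeping from L to R, each vertex is a crossing of the pseudolines at two
-- adjacent positions ℓ and ℓ+1 (0-indexed; paper level ℓ+1).

Level : ℕ → Set
Level n = Σ ℕ (λ ℓ → suc ℓ < n)

upperPos : ∀ {n} → Level n → Fin n
upperPos (ℓ , p) = fromℕ< (<⇒≤ p)

lowerPos : ∀ {n} → Level n → Fin n
lowerPos (ℓ , p) = fromℕ< p

-- A generalised arrangement: the list of levels of its vertices, left to right.
Arrangement : ℕ → Set
Arrangement n = List (Level n)

posAfter : ∀ {n} → List (Level n) → Fin n → Fin n
posAfter = foldl (λ f v → transpose (upperPos v) (lowerPos v) ∘ f) id

-- positions on a vertical line between vertex t-1 and vertex t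
posAt : ∀ {n} → Arrangement n → ℕ → Fin n → Fin n
posAt g t = posAfter (take t g)

-- S is a chamber set: the set of pseudolines above some chamber,
-- i.e. the top k pseudolines on some vertical slice.
IsChamberSet : ∀ {n} → Arrangement n → (Fin n → Set) → Set
IsChamberSet {n} g S =
  ∃[ t ] ∃[ k ] (t ≤ length g × k ≤ n × (∀ a → S a ⇔ (toℕ (posAt g t a) < k)))

VertexOf : ∀ {n} (g : Arrangement n) → Fin (length g) → Fin n → Fin n → Set
VertexOf g t i j =
  (p i ≡ upperPos v × p j ≡ lowerPos v) ⊎ (p i ≡ lowerPos v × p j ≡ upperPos v)
  where
    v = lookup g t
    p = posAt g (toℕ t)

levelOf : ∀ {n} (g : Arrangement n) → Fin (length g) → ℕ
levelOf g t = proj₁ (lookup g t)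

-- Linear orders on Fin n: r maps an alternative to its rank (0 = best).
LinOrder : ℕ → Set
LinOrder n = Permutation′ n

Prefers : ∀ {n} → LinOrder n → Fin n → Fin n → Set
Prefers r a b = (r ⟨$⟩ʳ a) F.< (r ⟨$⟩ʳ b)

InDomain : ∀ {n} → Arrangement n → LinOrder n → Set
InDomain {n} g r = ∀ k → k ≤ n → IsChamberSet g (λ a → toℕ (r ⟨$⟩ʳ a) < k)

support : ∀ {n} → List (LinOrder n) → Fin n → Fin n → ℕ
support P a b = length (filter (λ r → (r ⟨$⟩ʳ a) F.<? (r ⟨$⟩ʳ b)) P)

Majority : ∀ {n} → List (LinOrder n) → Fin n → Fin n → Set
Majority P a b = support P b a < support P a b

IsCondorcetDomain : ∀ {n} → (LinOrder n → Set) → Set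
IsCondorcetDomain {n} D =
  ∀ (P : List (LinOrder n)) → All D P → ∀ a → ¬ TransClosure (Majority P) a a

-- Sweeping the arrangement from left to right, the order of the pseudolines on
-- each vertical line between consecutive vertices belongs to D(g).  Let L_x and
-- L_y cross at levels l₁ < l₂.  The l₂ pseudolines above the second crossing
-- cannot all lie among the l₁ above the first one, so some L_c lies below both
-- L_x, L_y at the first crossing and above both at the second.  Around these
-- crossings the sweep meets the orders xyc, yxc and cxy, cyx on {x, y, c}; as a
-- vertex swaps a single pair, c has to pass between x and y on the way, so
-- xcy or ycx occurs as well.  Either one completes a Condorcet cycle with two
-- of the four orders above.

module Submission where

open import Defs
open import Data.Bool using (Bool; true; false)
import Data.Bool.Properties as Bool
open import Data.Fin as F using (Fin; toℕ; fromℕ<; inject≤)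
import Data.Fin.Properties as Fin
open import Data.Fin.Permutation as Perm using (Permutation′; _⟨$⟩ʳ_; _⟨$⟩ˡ_)
open import Data.List using (List; []; _∷_; _∷ʳ_; length; take; foldl; lookup)
open import Data.List.Properties using (take-suc; foldl-∷ʳ; filter-accept; filter-reject)
open import Data.List.Relation.Unary.All using ([]; _∷_)
open import Data.Nat using (ℕ; zero; suc; _≤_; _<_; z≤n; s≤s; _≤?_; _<?_; _<ᵇ_)
open import Data.Nat.Properties
open import Data.Product using (∃-syntax; _×_; _,_; proj₁; proj₂)
open import Data.Sum as Sum using (_⊎_; inj₁; inj₂; swap)
open import Function using (_∘_; id)
open import Function.Bundles using (mk⇔)
open import Function.Definitions using (Injective)
open import Relation.Binary.Construct.Closure.Transitive using ([_]; _∷_)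
open import Relation.Binary.Definitions using (tri<; tri≈; tri>)
open import Relation.Binary.PropositionalEquality
open import Relation.Nullary using (¬_; yes; no; contradiction)
open import Relation.Nullary.Reflects using (ofʸ; ofⁿ)
open import Relation.Nullary.Decidable using (_×-dec_; dec-true; dec-false; decidable-stable)

module _ {n : ℕ} where

  rank : LinOrder n → Fin n → ℕ
  rank r a = toℕ (r ⟨$⟩ʳ a)

  rank-injective : ∀ (r : LinOrder n) {a b} → rank r a ≡ rank r b → a ≡ b
  rank-injective r {a} {b} eq = begin
    a                  ≡⟨ Perm.inverseˡ r ⟨
    r ⟨$⟩ˡ (r ⟨$⟩ʳ a)  ≡⟨ cong (r ⟨$⟩ˡ_) (Fin.toℕ-injective eq) ⟩
    r ⟨$⟩ˡ (r ⟨$⟩ʳ b)  ≡⟨ Perm.inverseˡ r ⟩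
    b                  ∎
    where open ≡-Reasoning

  record Ranks (r : LinOrder n) (a b c : Fin n) : Set where
    constructor ranks
    field
      a≺b : Prefers r a b
      b≺c : Prefers r b c

  support-∷-prefers : ∀ r P a b → Prefers r a b → support (r ∷ P) a b ≡ suc (support P a b)
  support-∷-prefers r P a b p =
    cong length (filter-accept (λ (r′ : LinOrder n) → (r′ ⟨$⟩ʳ a) F.<? (r′ ⟨$⟩ʳ b)) p)

  support-∷-prefers-not : ∀ r P a b → Prefers r a b → support (r ∷ P) b a ≡ support P b a
  support-∷-prefers-not r P a b p =
    cong length (filter-reject (λ (r′ : LinOrder n) → (r′ ⟨$⟩ʳ b) F.<? (r′ ⟨$⟩ʳ a)) (<-asym p))

  cyclic-triple⇒¬condorcet : ∀ (D : LinOrder n → Set) {r₁ r₂ r₃ a b c} →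
    D r₁ → D r₂ → D r₃ → Ranks r₁ a b c → Ranks r₂ b c a → Ranks r₃ c a b →
    ¬ IsCondorcetDomain D
  cyclic-triple⇒¬condorcet D {r₁} {r₂} {r₃} {a} {b} {c}
    d₁ d₂ d₃ (ranks ab₁ bc₁) (ranks bc₂ ca₂) (ranks ca₃ ab₃) condorcet =
    condorcet (r₁ ∷ r₂ ∷ r₃ ∷ []) (d₁ ∷ d₂ ∷ d₃ ∷ []) a (a≻b ∷ b≻c ∷ [ c≻a ])
    where
      P₂ P₃ : List (LinOrder n)
      P₂ = r₂ ∷ r₃ ∷ []
      P₃ = r₃ ∷ []

      ac₁ : Prefers r₁ a c
      ac₁ = <-trans ab₁ bc₁
      ba₂ : Prefers r₂ b a
      ba₂ = <-trans bc₂ ca₂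
      cb₃ : Prefers r₃ c b
      cb₃ = <-trans ca₃ ab₃

      a≻b : Majority (r₁ ∷ P₂) a b
      a≻b rewrite support-∷-prefers     r₁ P₂ a b ab₁ | support-∷-prefers-not r₁ P₂ a b ab₁
                | support-∷-prefers     r₂ P₃ b a ba₂ | support-∷-prefers-not r₂ P₃ b a ba₂
                | support-∷-prefers     r₃ [] a b ab₃ | support-∷-prefers-not r₃ [] a b ab₃
                = s≤s (s≤s z≤n)

      b≻c : Majority (r₁ ∷ P₂) b c
      b≻c rewrite support-∷-prefers     r₁ P₂ b c bc₁ | support-∷-prefers-not r₁ P₂ b c bc₁
                | support-∷-prefers     r₂ P₃ b c bc₂ | support-∷-prefers-not r₂ P₃ b c bc₂
                | support-∷-prefers     r₃ [] c b cb₃ | support-∷-prefers-not r₃ [] c b cb₃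
                = s≤s (s≤s z≤n)

      c≻a : Majority (r₁ ∷ P₂) c a
      c≻a rewrite support-∷-prefers     r₁ P₂ a c ac₁ | support-∷-prefers-not r₁ P₂ a c ac₁
                | support-∷-prefers     r₂ P₃ c a ca₂ | support-∷-prefers-not r₂ P₃ c a ca₂
                | support-∷-prefers     r₃ [] c a ca₃ | support-∷-prefers-not r₃ [] c a ca₃
                = s≤s (s≤s z≤n)

  pigeonhole-ranks : ∀ (r r′ : LinOrder n) {k k′} → k < k′ → k′ ≤ n →
                     ∃[ c ] (rank r′ c < k′ × k ≤ rank r c)
  pigeonhole-ranks r r′ {k} {k′} k<k′ k′≤n
    with Fin.any? (λ c → (rank r′ c <? k′) ×-dec (k ≤? rank r c))
  ... | yes found = found
  ... | no none = contradiction (Fin.injective⇒≤ f-injective) (<⇒≱ k<k′)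
    where
      occupant : Fin k′ → Fin n
      occupant q = r′ ⟨$⟩ˡ inject≤ q k′≤n

      rank-occupant : ∀ q → rank r′ (occupant q) ≡ toℕ q
      rank-occupant q = trans (cong toℕ (Perm.inverseʳ r′)) (Fin.toℕ-inject≤ q k′≤n)

      occupant<k : ∀ q → rank r (occupant q) < k
      occupant<k q = ≰⇒> λ k≤rank →
        none (occupant q , subst (_< k′) (sym (rank-occupant q)) (Fin.toℕ<n q) , k≤rank)

      f : Fin k′ → Fin k
      f q = fromℕ< (occupant<k q)

      f-injective : Injective _≡_ _≡_ f
      f-injective {q} {q′} eq = Fin.toℕ-injective (begin
        toℕ q                 ≡⟨ rank-occupant q ⟨
        rank r′ (occupant q)  ≡⟨ cong (rank r′) (rank-injective r same-rank) ⟩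
        rank r′ (occupant q′) ≡⟨ rank-occupant q′ ⟩
        toℕ q′                ∎)
        where
          open ≡-Reasoning
          same-rank : rank r (occupant q) ≡ rank r (occupant q′)
          same-rank = trans (sym (Fin.toℕ-fromℕ< _)) (trans (cong toℕ eq) (Fin.toℕ-fromℕ< _))

transposeAdj : ℕ → ℕ → ℕ
transposeAdj zero    zero          = 1
transposeAdj zero    (suc zero)    = 0
transposeAdj zero    (suc (suc m)) = suc (suc m)
transposeAdj (suc l) zero          = zero
transposeAdj (suc l) (suc m)       = suc (transposeAdj l m)

transposeAdj-lower : ∀ l → transposeAdj l l ≡ suc l
transposeAdj-lower zero    = refl
transposeAdj-lower (suc l) = cong suc (transposeAdj-lower l)

transposeAdj-upper : ∀ l → transposeAdj l (suc l) ≡ l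
transposeAdj-upper zero    = refl
transposeAdj-upper (suc l) = cong suc (transposeAdj-upper l)

transposeAdj-other : ∀ l {m} → m ≢ l → m ≢ suc l → transposeAdj l m ≡ m
transposeAdj-other zero    {zero}          m≢l _     = contradiction refl m≢l
transposeAdj-other zero    {suc zero}      _   m≢1+l = contradiction refl m≢1+l
transposeAdj-other zero    {suc (suc m)}   _   _     = refl
transposeAdj-other (suc l) {zero}          _   _     = refl
transposeAdj-other (suc l) {suc m}         m≢l m≢1+l =
  cong suc (transposeAdj-other l (m≢l ∘ cong suc) (m≢1+l ∘ cong suc))

transposeAdj-reorders : ∀ l m k → (m <ᵇ k) ≢ (transposeAdj l m <ᵇ transposeAdj l k) →
                        k ≡ transposeAdj l m
transposeAdj-reorders zero    zero          (suc zero)    _  = refl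
transposeAdj-reorders zero    (suc zero)    zero          _  = refl
transposeAdj-reorders (suc l) (suc m)       (suc k)       ne =
  cong suc (transposeAdj-reorders l m k ne)
transposeAdj-reorders zero    zero          zero          ne = contradiction refl ne
transposeAdj-reorders zero    zero          (suc (suc k)) ne = contradiction refl ne
transposeAdj-reorders zero    (suc zero)    (suc zero)    ne = contradiction refl ne
transposeAdj-reorders zero    (suc zero)    (suc (suc k)) ne = contradiction refl ne
transposeAdj-reorders zero    (suc (suc m)) zero          ne = contradiction refl ne
transposeAdj-reorders zero    (suc (suc m)) (suc zero)    ne = contradiction refl ne
transposeAdj-reorders zero    (suc (suc m)) (suc (suc k)) ne = contradiction refl ne
transposeAdj-reorders (suc l) zero          zero          ne = contradiction refl ne
transposeAdj-reorders (suc l) zero          (suc k)       ne = contradiction refl ne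
transposeAdj-reorders (suc l) (suc m)       zero          ne = contradiction refl ne

<ᵇ-separates : ∀ m k n → (m <ᵇ k) ≢ (m <ᵇ n) → m ≢ k → m ≢ n →
               (k < m × m < n) ⊎ (n < m × m < k)
<ᵇ-separates m k n ne m≢k m≢n
  with m <ᵇ k | <ᵇ-reflects-< m k | m <ᵇ n | <ᵇ-reflects-< m n
... | true  | ofʸ m<k | false | ofⁿ m≮n = inj₂ (≤∧≢⇒< (≮⇒≥ m≮n) (m≢n ∘ sym) , m<k)
... | false | ofⁿ m≮k | true  | ofʸ m<n = inj₁ (≤∧≢⇒< (≮⇒≥ m≮k) (m≢k ∘ sym) , m<n)
... | true  | _       | true  | _       = contradiction refl ne
... | false | _       | false | _       = contradiction refl ne

module _ (X Y : ℕ → Bool) where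

  NoDoubleFlip : ℕ → Set
  NoDoubleFlip s = X s ≢ X (suc s) → Y s ≡ Y (suc s)

  leaves-diagonal-≤ : ∀ {m a b} → (∀ s → s < m → NoDoubleFlip s) → a ≤ b → b ≤ m →
                      X a ≡ Y a → X b ≡ Y b → X a ≢ X b → ∃[ s ] (s ≤ m × X s ≢ Y s)
  leaves-diagonal-≤ {b = zero} _ z≤n _ _ _ Xa≢Xb = contradiction refl Xa≢Xb
  leaves-diagonal-≤ {b = suc b} single a≤1+b b<m Xa≡Ya X1+b≡Y1+b Xa≢X1+b
    with m≤n⇒m<n∨m≡n a≤1+b | X b Bool.≟ Y b | X b Bool.≟ X (suc b)
  ... | inj₂ refl      | _         | _    = contradiction refl Xa≢X1+b
  ... | inj₁ _         | no  Xb≢Yb | _    = b , <⇒≤ b<m , Xb≢Yb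
  ... | inj₁ _         | yes Xb≡Yb | no flip =
    contradiction (trans Xb≡Yb (trans (single b b<m flip) (sym X1+b≡Y1+b))) flip
  ... | inj₁ (s≤s a≤b) | yes Xb≡Yb | yes Xb≡X1+b =
    leaves-diagonal-≤ single a≤b (<⇒≤ b<m) Xa≡Ya Xb≡Yb
                      (λ Xa≡Xb → Xa≢X1+b (trans Xa≡Xb Xb≡X1+b))

  leaves-diagonal : ∀ {m a b} → (∀ s → s < m → NoDoubleFlip s) → a ≤ m → b ≤ m →
                    X a ≡ Y a → X b ≡ Y b → X a ≢ X b → ∃[ s ] (s ≤ m × X s ≢ Y s)
  leaves-diagonal {a = a} {b} single a≤m b≤m Xa≡Ya Xb≡Yb Xa≢Xb with ≤-total a b
  ... | inj₁ a≤b = leaves-diagonal-≤ single a≤b b≤m Xa≡Ya Xb≡Yb Xa≢Xb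
  ... | inj₂ b≤a = leaves-diagonal-≤ single b≤a a≤m Xb≡Yb Xa≡Ya (Xa≢Xb ∘ sym)

module _ {n : ℕ} where

  transposeLevel : Level n → Permutation′ n
  transposeLevel v = Perm.transpose (upperPos v) (lowerPos v)

  toℕ-transposeLevel : ∀ (v : Level n) p →
                       toℕ (transposeLevel v ⟨$⟩ʳ p) ≡ transposeAdj (proj₁ v) (toℕ p)
  toℕ-transposeLevel v@(l , _) p with p Fin.≟ upperPos v
  ... | yes refl = trans (Fin.toℕ-fromℕ< _)
                         (sym (trans (cong (transposeAdj l) (Fin.toℕ-fromℕ< _)) (transposeAdj-lower l)))
  ... | no p≢upper with p Fin.≟ lowerPos v
  ...   | yes refl = trans (Fin.toℕ-fromℕ< _)
                           (sym (trans (cong (transposeAdj l) (Fin.toℕ-fromℕ< _)) (transposeAdj-upper l)))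
  ...   | no p≢lower = sym (transposeAdj-other l
            (λ p≡l → p≢upper (Fin.toℕ-injective (trans p≡l (sym (Fin.toℕ-fromℕ< _)))))
            (λ p≡1+l → p≢lower (Fin.toℕ-injective (trans p≡1+l (sym (Fin.toℕ-fromℕ< _))))))

  foldl-∘ₚ-⟨$⟩ʳ : ∀ {A : Set} (σ : A → Permutation′ n) (vs : List A)
                  (π : Permutation′ n) (f : Fin n → Fin n) → (∀ a → π ⟨$⟩ʳ a ≡ f a) →
    ∀ a → foldl (λ ρ v → ρ Perm.∘ₚ σ v) π vs ⟨$⟩ʳ a ≡ foldl (λ h v → (σ v ⟨$⟩ʳ_) ∘ h) f vs a
  foldl-∘ₚ-⟨$⟩ʳ σ []       π f π≗f = π≗f
  foldl-∘ₚ-⟨$⟩ʳ σ (v ∷ vs) π f π≗f =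
    foldl-∘ₚ-⟨$⟩ʳ σ vs (π Perm.∘ₚ σ v) ((σ v ⟨$⟩ʳ_) ∘ f) (cong (σ v ⟨$⟩ʳ_) ∘ π≗f)

module Sweep {n : ℕ} (g : Arrangement n) where

  slice : ℕ → LinOrder n
  slice s = foldl (λ π v → π Perm.∘ₚ transposeLevel v) Perm.id (take s g)

  slice-posAt : ∀ s a → slice s ⟨$⟩ʳ a ≡ posAt g s a
  slice-posAt s = foldl-∘ₚ-⟨$⟩ʳ transposeLevel (take s g) Perm.id id (λ _ → refl)

  slice∈D : ∀ {s} → s ≤ length g → InDomain g (slice s)
  slice∈D {s} s≤len k k≤n = s , k , s≤len , k≤n , λ a →
    mk⇔ (subst (λ p → toℕ p < k) (slice-posAt s a))
        (subst (λ p → toℕ p < k) (sym (slice-posAt s a)))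

  rankAt : ℕ → Fin n → ℕ
  rankAt s = rank (slice s)

  rankAt-posAt : ∀ s {a p} → posAt g s a ≡ p → rankAt s a ≡ toℕ p
  rankAt-posAt s {a} eq = cong toℕ (trans (slice-posAt s a) eq)

  rankAt-injective : ∀ s {a b} → rankAt s a ≡ rankAt s b → a ≡ b
  rankAt-injective s = rank-injective (slice s)

  rankAt-step : ∀ (t : Fin (length g)) a →
    rankAt (suc (toℕ t)) a ≡ transposeAdj (levelOf g t) (rankAt (toℕ t) a)
  rankAt-step t a = begin
    rankAt (suc T) a                        ≡⟨ rankAt-posAt (suc T) refl ⟩
    toℕ (posAfter (take (suc T) g) a)       ≡⟨ cong (λ vs → toℕ (posAfter vs a)) (take-suc g t) ⟩
    toℕ (posAfter (take T g ∷ʳ v) a)        ≡⟨ cong (λ f → toℕ (f a)) (foldl-∷ʳ _ id v (take T g)) ⟩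
    toℕ (transposeLevel v ⟨$⟩ʳ posAt g T a) ≡⟨ toℕ-transposeLevel v _ ⟩
    transposeAdj l (toℕ (posAt g T a))      ≡⟨ cong (transposeAdj l) (rankAt-posAt T refl) ⟨
    transposeAdj l (rankAt T a)             ∎
    where
      open ≡-Reasoning
      T : ℕ
      T = toℕ t
      v : Level n
      v = lookup g t
      l : ℕ
      l = levelOf g t

  double-flip⇒≡ : ∀ {s c x y} → s < length g →
    (rankAt s c <ᵇ rankAt s x) ≢ (rankAt (suc s) c <ᵇ rankAt (suc s) x) →
    (rankAt s c <ᵇ rankAt s y) ≢ (rankAt (suc s) c <ᵇ rankAt (suc s) y) → x ≡ y
  double-flip⇒≡ {s} {c} s<len flip-x flip-y =
    rankAt-injective s (trans (partner flip-x) (sym (partner flip-y)))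
    where
      t : Fin (length g)
      t = fromℕ< s<len
      l : ℕ
      l = levelOf g t

      step : ∀ a → rankAt (suc s) a ≡ transposeAdj l (rankAt s a)
      step a = subst (λ m → rankAt (suc m) a ≡ transposeAdj l (rankAt m a))
                     (Fin.toℕ-fromℕ< s<len) (rankAt-step t a)

      partner : ∀ {a} → (rankAt s c <ᵇ rankAt s a) ≢ (rankAt (suc s) c <ᵇ rankAt (suc s) a) →
                rankAt s a ≡ transposeAdj l (rankAt s c)
      partner {a} flip = transposeAdj-reorders l _ _
        (subst₂ (λ p q → (rankAt s c <ᵇ rankAt s a) ≢ (p <ᵇ q)) (step c) (step a) flip)

  record Adjacent (s l : ℕ) (x y : Fin n) : Set where
    constructor adjacent
    field
      upper : rankAt s x ≡ l
      lower : rankAt s y ≡ suc l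

  Crossing : ℕ → ℕ → Fin n → Fin n → Set
  Crossing s l x y = Adjacent s l x y ⊎ Adjacent s l y x

  vertexOf⇒crossing : ∀ {x y} (t : Fin (length g)) → VertexOf g t x y →
                      Crossing (toℕ t) (levelOf g t) x y
  vertexOf⇒crossing t (inj₁ (x-up , y-low)) =
    inj₁ (adjacent (trans (rankAt-posAt (toℕ t) x-up) (Fin.toℕ-fromℕ< _))
                   (trans (rankAt-posAt (toℕ t) y-low) (Fin.toℕ-fromℕ< _)))
  vertexOf⇒crossing t (inj₂ (x-low , y-up)) =
    swap (vertexOf⇒crossing t (inj₁ (y-up , x-low)))

  crossing-level≤ : ∀ {s l x y} → Crossing s l x y → l ≤ rankAt s x
  crossing-level≤ (inj₁ (adjacent x≡l _))   = ≤-reflexive (sym x≡l)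
  crossing-level≤ (inj₂ (adjacent _ x≡1+l)) = subst (_ ≤_) (sym x≡1+l) (n≤1+n _)

  below-crossing⇒≢ : ∀ {s l x y c} → Crossing s l x y → rankAt s c < l → c ≢ x
  below-crossing⇒≢ crossing c<l refl = <⇒≱ c<l (crossing-level≤ crossing)

  beyond-crossing : ∀ {s l x y c} → Crossing s l x y → c ≢ x → c ≢ y → l ≤ rankAt s c →
                    suc l < rankAt s c
  beyond-crossing {s} (inj₁ (adjacent x≡l y≡1+l)) c≢x c≢y l≤c =
    ≤∧≢⇒< (≤∧≢⇒< l≤c λ l≡c → c≢x (rankAt-injective s (trans (sym l≡c) (sym x≡l))))
          λ 1+l≡c → c≢y (rankAt-injective s (trans (sym 1+l≡c) (sym y≡1+l)))
  beyond-crossing (inj₂ y-above-x) c≢x c≢y = beyond-crossing (inj₁ y-above-x) c≢y c≢x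

  vertex-side : ∀ {x y c} (t : Fin (length g)) → Crossing (toℕ t) (levelOf g t) x y →
    rankAt (toℕ t) c ≢ levelOf g t → rankAt (toℕ t) c ≢ suc (levelOf g t) →
    ∃[ w ] (w ≤ length g × Adjacent w (levelOf g t) x y × rankAt w c ≡ rankAt (toℕ t) c)
  vertex-side t (inj₁ x-above-y) _ _ = toℕ t , <⇒≤ (Fin.toℕ<n t) , x-above-y , refl
  vertex-side {x} {y} {c} t (inj₂ (adjacent y≡l x≡1+l)) c≢l c≢1+l =
    suc (toℕ t) , Fin.toℕ<n t , (adjacent x≡l y≡1+l) , c-fixed
    where
      l : ℕ
      l = levelOf g t
      x≡l : rankAt (suc (toℕ t)) x ≡ l
      x≡l = trans (rankAt-step t x) (trans (cong (transposeAdj l) x≡1+l) (transposeAdj-upper l))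
      y≡1+l : rankAt (suc (toℕ t)) y ≡ suc l
      y≡1+l = trans (rankAt-step t y) (trans (cong (transposeAdj l) y≡l) (transposeAdj-lower l))
      c-fixed : rankAt (suc (toℕ t)) c ≡ rankAt (toℕ t) c
      c-fixed = trans (rankAt-step t c) (transposeAdj-other l c≢l c≢1+l)

  SliceRanks : Fin n → Fin n → Fin n → Set
  SliceRanks a b c = ∃[ s ] (s ≤ length g × Ranks (slice s) a b c)

  passes-between : ∀ {x y c} → SliceRanks x y c → SliceRanks c x y →
                   SliceRanks x c y ⊎ SliceRanks y c x
  passes-between {x} {y} {c} (w , w≤len , ranks x<y y<c) (w′ , w′≤len , ranks c<x x<y′) =
    separate (leaves-diagonal X Y no-double-flip w≤len w′≤len
               (trans X-below (sym Y-below)) (trans X-above (sym Y-above))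
               (subst₂ _≢_ (sym X-below) (sym X-above) λ ()))
    where
      X Y : ℕ → Bool
      X s = rankAt s c <ᵇ rankAt s x
      Y s = rankAt s c <ᵇ rankAt s y

      X-below : X w ≡ false
      X-below = dec-false (_ <? _) (<-asym (<-trans x<y y<c))
      Y-below : Y w ≡ false
      Y-below = dec-false (_ <? _) (<-asym y<c)
      X-above : X w′ ≡ true
      X-above = dec-true (_ <? _) c<x
      Y-above : Y w′ ≡ true
      Y-above = dec-true (_ <? _) (<-trans c<x x<y′)

      ranked-apart : ∀ {a b} → rankAt w a < rankAt w b → ∀ s → rankAt s b ≢ rankAt s a
      ranked-apart a<b s eq = <⇒≢ a<b (cong (rankAt w) (sym (rankAt-injective s eq)))

      no-double-flip : ∀ s → s < length g → NoDoubleFlip X Y s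
      no-double-flip s s<len flip-x = decidable-stable (Y s Bool.≟ Y (suc s))
        λ flip-y → <-irrefl (cong (rankAt w) (double-flip⇒≡ s<len flip-x flip-y)) x<y

      separate : ∃[ s ] (s ≤ length g × X s ≢ Y s) → SliceRanks x c y ⊎ SliceRanks y c x
      separate (s , s≤len , Xs≢Ys) =
        Sum.map (λ (x<c , c<y) → s , s≤len , ranks x<c c<y)
                (λ (y<c , c<x) → s , s≤len , ranks y<c c<x)
          (<ᵇ-separates _ _ _ Xs≢Ys (ranked-apart (<-trans x<y y<c) s) (ranked-apart y<c s))

  vertex-below : ∀ {x y c} (t : Fin (length g)) → Crossing (toℕ t) (levelOf g t) x y →
                 suc (levelOf g t) < rankAt (toℕ t) c → SliceRanks x y c
  vertex-below t crossing 1+l<c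
    with vertex-side t crossing (>⇒≢ (<-trans (n<1+n _) 1+l<c)) (>⇒≢ 1+l<c)
  ... | w , w≤len , (adjacent x≡l y≡1+l) , c-fixed =
    w , w≤len , ranks (subst₂ _<_ (sym x≡l) (sym y≡1+l) (n<1+n _))
                      (subst₂ _<_ (sym y≡1+l) (sym c-fixed) 1+l<c)

  vertex-above : ∀ {x y c} (t : Fin (length g)) → Crossing (toℕ t) (levelOf g t) x y →
                 rankAt (toℕ t) c < levelOf g t → SliceRanks c x y
  vertex-above t crossing c<l
    with vertex-side t crossing (<⇒≢ c<l) (<⇒≢ (<-trans c<l (n<1+n _)))
  ... | w , w≤len , (adjacent x≡l y≡1+l) , c-fixed =
    w , w≤len , ranks (subst₂ _<_ (sym c-fixed) (sym x≡l) c<l)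
                      (subst₂ _<_ (sym x≡l) (sym y≡1+l) (n<1+n _))

  cyclic-slices⇒¬condorcet : ∀ {a b c} →
    SliceRanks a b c → SliceRanks b c a → SliceRanks c a b → ¬ IsCondorcetDomain (InDomain g)
  cyclic-slices⇒¬condorcet (_ , s₁ , abc) (_ , s₂ , bca) (_ , s₃ , cab) =
    cyclic-triple⇒¬condorcet (InDomain g) (slice∈D s₁) (slice∈D s₂) (slice∈D s₃) abc bca cab

  four-orders⇒¬condorcet : ∀ {x y c} → SliceRanks x y c → SliceRanks y x c →
    SliceRanks c x y → SliceRanks c y x → ¬ IsCondorcetDomain (InDomain g)
  four-orders⇒¬condorcet xyc yxc cxy cyx =
    Sum.[ (λ xcy → cyclic-slices⇒¬condorcet xcy cyx yxc)
        , (λ ycx → cyclic-slices⇒¬condorcet ycx cxy xyc)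
        ] (passes-between xyc cxy)

  separating-pseudoline : ∀ {s₁ s₂ l₁ l₂ x y} → Crossing s₁ l₁ x y → Crossing s₂ l₂ x y →
    l₁ < l₂ → l₂ ≤ n → ∃[ c ] (rankAt s₂ c < l₂ × suc l₁ < rankAt s₁ c)
  separating-pseudoline {s₁} {s₂} cr₁ cr₂ l₁<l₂ l₂≤n
    with pigeonhole-ranks (slice s₁) (slice s₂) l₁<l₂ l₂≤n
  ... | c , c<l₂ , l₁≤c =
    c , c<l₂ , beyond-crossing cr₁ (below-crossing⇒≢ cr₂ c<l₂) (below-crossing⇒≢ (swap cr₂) c<l₂)
                               l₁≤c

  double-crossing⇒¬condorcet : ∀ {x y} (t₁ t₂ : Fin (length g)) →
    VertexOf g t₁ x y → VertexOf g t₂ x y → levelOf g t₁ < levelOf g t₂ →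
    ¬ IsCondorcetDomain (InDomain g)
  double-crossing⇒¬condorcet {x} {y} t₁ t₂ v₁ v₂ l₁<l₂ =
    let (_ , c-above , c-below) = separating-pseudoline cr₁ cr₂ l₁<l₂ l₂≤n
    in four-orders⇒¬condorcet
         (vertex-below t₁ cr₁ c-below) (vertex-below t₁ (swap cr₁) c-below)
         (vertex-above t₂ cr₂ c-above) (vertex-above t₂ (swap cr₂) c-above)
    where
      cr₁ : Crossing (toℕ t₁) (levelOf g t₁) x y
      cr₁ = vertexOf⇒crossing t₁ v₁
      cr₂ : Crossing (toℕ t₂) (levelOf g t₂) x y
      cr₂ = vertexOf⇒crossing t₂ v₂
      l₂≤n : levelOf g t₂ ≤ n
      l₂≤n = ≤-trans (n≤1+n _) (<⇒≤ (proj₂ (lookup g t₂)))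

open Sweep using (double-crossing⇒¬condorcet)

mainTheorem1 : (n : ℕ) (g : Arrangement n) →
    (∃[ i ] ∃[ j ] ∃[ t₁ ] ∃[ t₂ ]
      (VertexOf g t₁ i j × VertexOf g t₂ i j × levelOf g t₁ ≢ levelOf g t₂)) →
    ¬ IsCondorcetDomain (InDomain g)
mainTheorem1 n g (i , j , t₁ , t₂ , v₁ , v₂ , l₁≢l₂) with <-cmp (levelOf g t₁) (levelOf g t₂)
... | tri< l₁<l₂ _ _ = double-crossing⇒¬condorcet g t₁ t₂ v₁ v₂ l₁<l₂
... | tri≈ _ l₁≡l₂ _ = contradiction l₁≡l₂ l₁≢l₂
... | tri> _ _ l₂<l₁ = double-crossing⇒¬condorcet g t₂ t₁ v₂ v₁ l₂<l₁
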